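{- Let $m$ be a positive integer and let $v=(v_1,\ldots,v_q,v_{q+1},\ldots,v_n)$ be an integral vector with $0<q\le n$, $v_i\not\equiv0\pmod m$ for $i\in\{1,\ldots,q\}$ and $v_j\equiv0\pmod m$ for $j\in\{q+1,\ldots,n\}$. Let $w=(w_1,\ldots,w_n)$ be a perfect $m$-representative of $v$ and $u=(u_1,\ldots,u_n)$ the shortest $m$-representative of $v$. Then: (i) $u_i\ne0$ and $w_i\ne0$ for $i\in\{1,\ldots,q\}$, and $u_j=w_j=0$ for $j\in\{q+1,\ldots,n\}$; (ii) the Hamming distance between $(w_1,\ldots,w_q)$ and $(u_1,\ldots,u_q)$ is at most $3$; moreover, for every $i\in\{1,\ldots,q\}$ with $w_i\ne u_i$, either $w_i=u_i-m$ and $u_i>0$, or $w_i=u_i+m$ and $u_i<0$.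
   Context: Let $e$ be the all-ones vector. For a positive integer $m$ and an integral vector $v$, an integral vector $w$ is a perfect $m$-representative of $v$ if $w\equiv v\pmod m$ (entrywise), $e^Tw=m$ and $w^Tw=m^2$. The shortest $m$-representative of $v$ is the unique integral vector $u$ with $u\equiv v\pmod m$ and $-m/2<u_i\le m/2$ for all $i$. The Hamming distance between two vectors is the number of positions in which they differ. -}

module Defs where

open import Data.Nat using (ℕ; zero; suc; NonZero)
open import Data.Integer using (ℤ; +_; _-_; _*_; _+_; _<_; _≤_; -_)
open import Data.Integer.Divisibility using (_∣_)
open import Data.Fin using (Fin; toℕ)
open import Data.List using (List; length; filter; foldr; map)
open import Data.List.Base using ()
open import Data.Fin.Base using ()
open import Data.List using (allFin)
open import Relation.Nullary using (¬_; Dec)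
open import Relation.Nullary.Decidable using (¬?; _×-dec_)
open import Data.Product using (_×_)
open import Data.Integer using (_≟_)
open import Data.Nat using () renaming (_<?_ to _<ℕ?_; _<_ to _<ℕ_)
open import Relation.Binary.PropositionalEquality using (_≡_)

IVec : ℕ → Set
IVec n = Fin n → ℤ

_≡_[mod_] : ℤ → ℤ → ℕ → Set
a ≡ b [mod m ] = (+ m) ∣ (a - b)

_≡ᵥ_[mod_] : ∀ {n} → IVec n → IVec n → ℕ → Set
w ≡ᵥ v [mod m ] = ∀ i → w i ≡ v i [mod m ]

eᵀ : ∀ {n} → IVec n → ℤ
eᵀ {n} w = foldr _+_ (+ 0) (map w (allFin n))

sqNorm : ∀ {n} → IVec n → ℤ
sqNorm {n} w = foldr _+_ (+ 0) (map (λ i → w i * w i) (allFin n))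

IsPerfectRep : ∀ {n} → ℕ → IVec n → IVec n → Set
IsPerfectRep m v w = (w ≡ᵥ v [mod m ]) × (eᵀ w ≡ + m) × (sqNorm w ≡ (+ m) * (+ m))

-- u is the shortest m-representative of v: u ≡ v (mod m) and -m/2 < u_i ≤ m/2
-- (written without division as  -m < 2 u_i ≤ m)
IsShortestRep : ∀ {n} → ℕ → IVec n → IVec n → Set
IsShortestRep m v u = (u ≡ᵥ v [mod m ]) × (∀ i → (- (+ m) < (+ 2) * u i) × ((+ 2) * u i ≤ + m))

hammingPrefix : ∀ {n} → ℕ → IVec n → IVec n → ℕ
hammingPrefix {n} q w u =
  length (filter (λ i → (toℕ i <ℕ? q) ×-dec ¬? (w i ≟ u i)) (allFin n))

{-# OPTIONS --safe #-}
-- Since ∑ wᵢ² = m², every ∣wᵢ∣ ≤ m, while the shortest representative has 2∣uᵢ∣ ≤ m.  A multiple of m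
-- of that size is 0, except that some wⱼ = ±m would use up the whole norm, impossible as w₁ ≠ 0.  As
-- wᵢ ≡ uᵢ (mod m), the difference wᵢ - uᵢ lies in {-m, 0, m}, and ∣wᵢ∣ ≤ m fixes the sign of a nonzero shift.
-- For the Hamming bound, 4(x² - x) = (2x - 1)² - 1 is nonnegative on ℤ and at least m² - 1 at a shifted
-- entry, where ∣2wᵢ - 1∣ ≥ m.  Summing, h (m² - 1) ≤ 4 (∑ wᵢ² - ∑ wᵢ) = 4 (m² - m), so h ≤ 3 as m ≥ 2.
module Submission where

open import Defs
open import Data.Nat using (ℕ; NonZero; _≤_)
open import Data.Nat using () renaming (_<_ to _<ℕ_)
open import Data.Integer using (ℤ; +_; _+_; _-_; _<_; _>_)
open import Data.Fin using (Fin; toℕ)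
open import Data.Product using (_×_)
open import Data.Sum using (_⊎_)
open import Relation.Binary.PropositionalEquality using (_≡_; _≢_)
open import Relation.Nullary using (¬_)

import Data.Nat as ℕ
import Data.Nat.Properties as ℕ
import Data.Nat.Divisibility as ℕ
open import Data.Integer using (0ℤ; 1ℤ; -_; _*_; ∣_∣; -[1+_]; +≤+; -≤+; +<+; nonNegative) renaming (_≤_ to _≤ℤ_)
import Data.Integer.Properties as ℤ
import Data.Integer.Divisibility.Signed as Signed
open import Data.Integer.Tactic.RingSolver using (solve-∀)
open import Data.List using (List; []; _∷_; foldr; map; filter; length; allFin)
open import Data.List.Membership.Propositional using (_∈_)
open import Data.List.Membership.Propositional.Properties using (∈-allFin)
open import Data.List.Relation.Unary.Any using (here; there)
open import Data.Product using (_,_; proj₁; proj₂)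
open import Data.Sum using (inj₁; inj₂)
import Data.Sum as Sum
import Data.Fin as Fin
open import Function using (_∘_)
open import Relation.Binary.PropositionalEquality using (refl; sym; trans; cong; cong₂; subst; subst₂)
open import Relation.Nullary using (yes; no; contradiction)
open import Relation.Nullary.Decidable using (¬?; _×-dec_)
open import Relation.Unary using (Pred; Decidable)

∑ : {A : Set} → (A → ℤ) → List A → ℤ
∑ f xs = foldr _+_ 0ℤ (map f xs)

module _ {A : Set} {f : A → ℤ} (f≥0 : ∀ x → 0ℤ ≤ℤ f x) where

  ∑-nonNeg : ∀ xs → 0ℤ ≤ℤ ∑ f xs
  ∑-nonNeg []       = ℤ.≤-refl
  ∑-nonNeg (x ∷ xs) = ℤ.+-mono-≤ (f≥0 x) (∑-nonNeg xs)

  ∈⇒≤∑ : ∀ {x xs} → x ∈ xs → f x ≤ℤ ∑ f xs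
  ∈⇒≤∑ {xs = y ∷ ys} (here refl) = ℤ.i≤i+j (f y) (∑ f ys) {{nonNegative (∑-nonNeg ys)}}
  ∈⇒≤∑ {xs = y ∷ ys} (there x∈ys) = ℤ.≤-trans (∈⇒≤∑ x∈ys) (ℤ.i≤j+i _ (f y) {{nonNegative (f≥0 y)}})

  ∈∧∈⇒+≤∑ : ∀ {x y xs} → x ≢ y → x ∈ xs → y ∈ xs → f x + f y ≤ℤ ∑ f xs
  ∈∧∈⇒+≤∑ x≢y (here refl) (here refl) = contradiction refl x≢y
  ∈∧∈⇒+≤∑ {x} x≢y (here refl) (there y∈zs) = ℤ.+-monoʳ-≤ (f x) (∈⇒≤∑ y∈zs)
  ∈∧∈⇒+≤∑ {x} {y} x≢y (there x∈zs) (here refl) =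
    subst (_≤ℤ _) (ℤ.+-comm (f y) (f x)) (ℤ.+-monoʳ-≤ (f y) (∈⇒≤∑ x∈zs))
  ∈∧∈⇒+≤∑ {xs = z ∷ _} x≢y (there x∈zs) (there y∈zs) =
    ℤ.≤-trans (∈∧∈⇒+≤∑ x≢y x∈zs y∈zs) (ℤ.i≤j+i _ (f z) {{nonNegative (f≥0 z)}})

  length-filter*≤∑ : ∀ {ℓ} {P : Pred A ℓ} (P? : Decidable P) {c : ℤ} →
    (∀ x → P x → c ≤ℤ f x) → ∀ xs → + length (filter P? xs) * c ≤ℤ ∑ f xs
  length-filter*≤∑ P? P⇒c≤f [] = ℤ.≤-refl
  length-filter*≤∑ P? {c} P⇒c≤f (x ∷ xs) with P? x
  ... | yes Px = subst (_≤ℤ f x + ∑ f xs) (sym (*-suc (length (filter P? xs))))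
                   (ℤ.+-mono-≤ (P⇒c≤f x Px) (length-filter*≤∑ P? P⇒c≤f xs))
    where
    *-suc : ∀ n → + ℕ.suc n * c ≡ c + + n * c
    *-suc n = trans (ℤ.*-distribʳ-+ c 1ℤ (+ n)) (cong (_+ + n * c) (ℤ.*-identityˡ c))
  ... | no _   = ℤ.≤-trans (length-filter*≤∑ P? P⇒c≤f xs) (ℤ.i≤j+i _ (f x) {{nonNegative (f≥0 x)}})

*-distribˡ-∑ : {A : Set} (k : ℤ) (f : A → ℤ) → ∀ xs → k * ∑ f xs ≡ ∑ (λ x → k * f x) xs
*-distribˡ-∑ k f []       = ℤ.*-zeroʳ k
*-distribˡ-∑ k f (x ∷ xs) =
  trans (ℤ.*-distribˡ-+ k (f x) (∑ f xs)) (cong (_+_ (k * f x)) (*-distribˡ-∑ k f xs))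

∑-distrib-sub : {A : Set} (f g : A → ℤ) → ∀ xs → ∑ (λ x → f x - g x) xs ≡ ∑ f xs - ∑ g xs
∑-distrib-sub f g []       = refl
∑-distrib-sub f g (x ∷ xs) =
  trans (cong (_+_ (f x - g x)) (∑-distrib-sub f g xs)) (interchange (f x) (g x) (∑ f xs) (∑ g xs))
  where
  interchange : ∀ a b c d → (a - b) + (c - d) ≡ (a + c) - (b + d)
  interchange = solve-∀

+-cancelʳ-≤ : ∀ {i j} k → i + k ≤ℤ j + k → i ≤ℤ j
+-cancelʳ-≤ {i} {j} k i+k≤j+k = subst₂ _≤ℤ_ (cancel i k) (cancel j k) (ℤ.+-monoˡ-≤ (- k) i+k≤j+k)
  where
  cancel : ∀ i k → i + k - k ≡ i
  cancel = solve-∀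

i*i≡∣i∣*∣i∣ : ∀ i → i * i ≡ + (∣ i ∣ ℕ.* ∣ i ∣)
i*i≡∣i∣*∣i∣ (+ n)    = sym (ℤ.pos-* n n)
i*i≡∣i∣*∣i∣ -[1+ n ] = refl

i*i-nonNeg : ∀ i → 0ℤ ≤ℤ i * i
i*i-nonNeg i = subst (0ℤ ≤ℤ_) (sym (i*i≡∣i∣*∣i∣ i)) (+≤+ ℕ.z≤n)

∣i∣≤∣j∣⇒i*i≤j*j : ∀ {i j} → ∣ i ∣ ℕ.≤ ∣ j ∣ → i * i ≤ℤ j * j
∣i∣≤∣j∣⇒i*i≤j*j {i} {j} ∣i∣≤∣j∣ =
  subst₂ _≤ℤ_ (sym (i*i≡∣i∣*∣i∣ i)) (sym (i*i≡∣i∣*∣i∣ j)) (+≤+ (ℕ.*-mono-≤ ∣i∣≤∣j∣ ∣i∣≤∣j∣))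

i*i≤j*j⇒∣i∣≤∣j∣ : ∀ {i j} → i * i ≤ℤ j * j → ∣ i ∣ ℕ.≤ ∣ j ∣
i*i≤j*j⇒∣i∣≤∣j∣ {i} {j} i*i≤j*j = ℕ.≮⇒≥ λ ∣j∣<∣i∣ →
  ℕ.<⇒≱ (ℕ.*-mono-< ∣j∣<∣i∣ ∣j∣<∣i∣)
    (ℤ.drop‿+≤+ (subst₂ _≤ℤ_ (i*i≡∣i∣*∣i∣ i) (i*i≡∣i∣*∣i∣ j) i*i≤j*j))

i*i-i-nonNeg : ∀ i → 0ℤ ≤ℤ i * i - i
i*i-i-nonNeg i = subst (0ℤ ≤ℤ_) (factor i) (i*[i-1]-nonNeg i)
  where
  factor : ∀ i → i * (i - 1ℤ) ≡ i * i - i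
  factor = solve-∀
  i*[i-1]-nonNeg : ∀ i → 0ℤ ≤ℤ i * (i - 1ℤ)
  i*[i-1]-nonNeg (+ 0)       = +≤+ ℕ.z≤n
  i*[i-1]-nonNeg (+ ℕ.suc n) = subst (0ℤ ≤ℤ_) (ℤ.pos-* (ℕ.suc n) n) (+≤+ ℕ.z≤n)
  i*[i-1]-nonNeg -[1+ n ]    = +≤+ ℕ.z≤n

∣i∣≤n⇒-n≤i≤n : ∀ {i n} → ∣ i ∣ ℕ.≤ n → (- + n ≤ℤ i) × (i ≤ℤ + n)
∣i∣≤n⇒-n≤i≤n {+ _}      ∣i∣≤n = ℤ.neg-≤-pos , +≤+ ∣i∣≤n
∣i∣≤n⇒-n≤i≤n { -[1+ _ ]} ∣i∣≤n = ℤ.neg-mono-≤ (+≤+ ∣i∣≤n) , -≤+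

-n≤i≤n⇒∣i∣≤n : ∀ {i n} → - + n ≤ℤ i → i ≤ℤ + n → ∣ i ∣ ℕ.≤ n
-n≤i≤n⇒∣i∣≤n {+ _}      _     i≤n = ℤ.drop‿+≤+ i≤n
-n≤i≤n⇒∣i∣≤n { -[1+ _ ]} {n} -n≤i _ =
  ℤ.drop‿+≤+ (subst (_ ≤ℤ_) (ℤ.neg-involutive (+ n)) (ℤ.neg-mono-≤ -n≤i))

+n≤i⇒n≤∣i∣ : ∀ {i n} → + n ≤ℤ i → n ℕ.≤ ∣ i ∣
+n≤i⇒n≤∣i∣ (+≤+ n≤i) = n≤i

i≤-n⇒n≤∣i∣ : ∀ {i n} → i ≤ℤ - + n → n ℕ.≤ ∣ i ∣
i≤-n⇒n≤∣i∣ {i} {n} i≤-n = subst (n ℕ.≤_) (ℤ.∣-i∣≡∣i∣ i)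
  (+n≤i⇒n≤∣i∣ (subst (_≤ℤ - i) (ℤ.neg-involutive (+ n)) (ℤ.neg-mono-≤ i≤-n)))

m∣∣i∣⇒m≤∣i∣ : ∀ {m i} → m ℕ.∣ ∣ i ∣ → i ≢ 0ℤ → m ℕ.≤ ∣ i ∣
m∣∣i∣⇒m≤∣i∣ {i = i} m∣i i≢0 = ℕ.∣⇒≤ {{ℕ.≢-nonZero (i≢0 ∘ ℤ.∣i∣≡0⇒i≡0)}} m∣i

2*n≤n⇒n≡0 : ∀ n → 2 ℕ.* n ℕ.≤ n → n ≡ 0
2*n≤n⇒n≡0 0           _      = refl
2*n≤n⇒n≡0 (ℕ.suc n) 2*n≤n = contradiction 2*n≤n (ℕ.m+1+n≰m (ℕ.suc n))

≡[mod]-sym : ∀ {m a b} → a ≡ b [mod m ] → b ≡ a [mod m ]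
≡[mod]-sym {m} {a} {b} = subst (m ℕ.∣_) (ℤ.∣i-j∣≡∣j-i∣ a b)

≡[mod]-trans : ∀ {m a b c} → a ≡ b [mod m ] → b ≡ c [mod m ] → a ≡ c [mod m ]
≡[mod]-trans {m} {a} {b} {c} a≡b b≡c =
  Signed.∣⇒∣ᵤ (subst (+ m Signed.∣_) (telescope a b c)
    (Signed.∣m∣n⇒∣m+n (Signed.∣ᵤ⇒∣ {i = a - b} a≡b) (Signed.∣ᵤ⇒∣ {i = b - c} b≡c)))
  where
  telescope : ∀ a b c → (a - b) + (b - c) ≡ a - c
  telescope = solve-∀

≡0[mod]⇒∣ : ∀ {m x} → x ≡ + 0 [mod m ] → m ℕ.∣ ∣ x ∣
≡0[mod]⇒∣ {m} {x} = subst (m ℕ.∣_) (cong ∣_∣ (ℤ.+-identityʳ x))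

≢0[mod]⇒≢0 : ∀ {m x v} → x ≡ v [mod m ] → ¬ (v ≡ + 0 [mod m ]) → x ≢ 0ℤ
≢0[mod]⇒≢0 {m} {x} {v} x≡v v≢0 x≡0 = v≢0 (subst (λ t → v ≡ t [mod m ]) x≡0 (≡[mod]-sym {m} {x} x≡v))

-m<2u≤m⇒2∣u∣≤m : ∀ {u m} → - + m < + 2 * u → + 2 * u ≤ℤ + m → 2 ℕ.* ∣ u ∣ ℕ.≤ m
-m<2u≤m⇒2∣u∣≤m {u} -m<2u 2u≤m = subst (ℕ._≤ _) (ℤ.abs-* (+ 2) u) (-n≤i≤n⇒∣i∣≤n (ℤ.<⇒≤ -m<2u) 2u≤m)

2∣u∣≤m∧u≢0⇒2≤m : ∀ {u m} → 2 ℕ.* ∣ u ∣ ℕ.≤ m → u ≢ 0ℤ → 2 ℕ.≤ m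
2∣u∣≤m∧u≢0⇒2≤m 2∣u∣≤m u≢0 =
  ℕ.≤-trans (ℕ.*-monoʳ-≤ 2 (ℕ.n≢0⇒n>0 (u≢0 ∘ ℤ.∣i∣≡0⇒i≡0))) 2∣u∣≤m

≡0[mod]∧2∣u∣≤m⇒u≡0 : ∀ {m u} → u ≡ + 0 [mod m ] → 2 ℕ.* ∣ u ∣ ℕ.≤ m → u ≡ 0ℤ
≡0[mod]∧2∣u∣≤m⇒u≡0 {u = u} u≡0 2∣u∣≤m with u ℤ.≟ 0ℤ
... | yes u≡0ℤ = u≡0ℤ
... | no  u≢0  = contradiction (2*n≤n⇒n≡0 ∣ u ∣ (ℕ.≤-trans 2∣u∣≤m (m∣∣i∣⇒m≤∣i∣ (≡0[mod]⇒∣ {x = u} u≡0) u≢0)))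
                   (u≢0 ∘ ℤ.∣i∣≡0⇒i≡0)

∣x-y∣≡m⇒shift : ∀ {m x y} → ∣ x - y ∣ ≡ m → ∣ x ∣ ℕ.≤ m → y ≢ 0ℤ →
  ((x ≡ y - + m) × (y > 0ℤ)) ⊎ ((x ≡ y + + m) × (y < 0ℤ))
∣x-y∣≡m⇒shift {m} {x} {y} ∣x-y∣≡m ∣x∣≤m y≢0 with ℤ.+∣i∣≡i⊎+∣i∣≡-i (x - y)
... | inj₁ +∣x-y∣≡x-y = inj₂ (x≡y+m , ℤ.≤∧≢⇒< y≤0 y≢0)
  where
  x≡y+m : x ≡ y + + m
  x≡y+m = trans (split x y) (cong (_+_ y) (trans (sym +∣x-y∣≡x-y) (cong +_ ∣x-y∣≡m)))
    where
    split : ∀ x y → x ≡ y + (x - y)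
    split = solve-∀
  y≤0 : y ≤ℤ 0ℤ
  y≤0 = +-cancelʳ-≤ (+ m) (subst (_≤ℤ + m) x≡y+m (proj₂ (∣i∣≤n⇒-n≤i≤n ∣x∣≤m)))
... | inj₂ +∣x-y∣≡y-x = inj₁ (x≡y-m , ℤ.≤∧≢⇒< 0≤y (y≢0 ∘ sym))
  where
  x≡y-m : x ≡ y - + m
  x≡y-m = trans (split x y) (cong (λ d → y - d) (trans (sym +∣x-y∣≡y-x) (cong +_ ∣x-y∣≡m)))
    where
    split : ∀ x y → x ≡ y - - (x - y)
    split = solve-∀
  0≤y : 0ℤ ≤ℤ y
  0≤y = +-cancelʳ-≤ (- + m)
    (subst₂ _≤ℤ_ (sym (ℤ.+-identityˡ (- + m))) x≡y-m (proj₁ (∣i∣≤n⇒-n≤i≤n ∣x∣≤m)))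

-- 2∣x - y∣ ≤ 3m leaves only ∣x - y∣ ∈ {0, m}.
congruent-shift : ∀ {m x y} → x ≡ y [mod m ] → ∣ x ∣ ℕ.≤ m → 2 ℕ.* ∣ y ∣ ℕ.≤ m → y ≢ 0ℤ → x ≢ y →
  ((x ≡ y - + m) × (y > 0ℤ)) ⊎ ((x ≡ y + + m) × (y < 0ℤ))
congruent-shift {m} {x} {y} (ℕ.divides k ∣x-y∣≡k*m) ∣x∣≤m 2∣y∣≤m y≢0 x≢y = by-quotient k ∣x-y∣≡k*m
  where
  instance
    m≢0 : NonZero m
    m≢0 = ℕ.>-nonZero (ℕ.<-trans ℕ.0<1+n (2∣u∣≤m∧u≢0⇒2≤m 2∣y∣≤m y≢0))

  2∣x-y∣≤3m : 2 ℕ.* ∣ x - y ∣ ℕ.≤ 3 ℕ.* m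
  2∣x-y∣≤3m = begin
    2 ℕ.* ∣ x - y ∣               ≤⟨ ℕ.*-monoʳ-≤ 2 (ℤ.∣i-j∣≤∣i∣+∣j∣ x y) ⟩
    2 ℕ.* (∣ x ∣ ℕ.+ ∣ y ∣)       ≡⟨ ℕ.*-distribˡ-+ 2 ∣ x ∣ ∣ y ∣ ⟩
    2 ℕ.* ∣ x ∣ ℕ.+ 2 ℕ.* ∣ y ∣   ≤⟨ ℕ.+-mono-≤ (ℕ.*-monoʳ-≤ 2 ∣x∣≤m) 2∣y∣≤m ⟩
    2 ℕ.* m ℕ.+ m                 ≡⟨ ℕ.+-comm (2 ℕ.* m) m ⟩
    3 ℕ.* m                       ∎
    where open ℕ.≤-Reasoning

  by-quotient : ∀ k → ∣ x - y ∣ ≡ k ℕ.* m → ((x ≡ y - + m) × (y > 0ℤ)) ⊎ ((x ≡ y + + m) × (y < 0ℤ))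
  by-quotient 0 ∣x-y∣≡0 = contradiction (ℤ.i-j≡0⇒i≡j x y (ℤ.∣i∣≡0⇒i≡0 ∣x-y∣≡0)) x≢y
  by-quotient 1 ∣x-y∣≡1*m = ∣x-y∣≡m⇒shift (trans ∣x-y∣≡1*m (ℕ.*-identityˡ m)) ∣x∣≤m y≢0
  by-quotient (ℕ.suc (ℕ.suc k)) ∣x-y∣≡[2+k]*m = contradiction 2∣x-y∣≤3m (ℕ.<⇒≱ (begin-strict
    3 ℕ.* m                          <⟨ ℕ.*-monoˡ-< m (ℕ.n<1+n 3) ⟩
    4 ℕ.* m                          ≡⟨ ℕ.*-assoc 2 2 m ⟩
    2 ℕ.* (2 ℕ.* m)                  ≤⟨ ℕ.*-monoʳ-≤ 2 (ℕ.*-monoˡ-≤ m (ℕ.m≤m+n 2 k)) ⟩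
    2 ℕ.* ((2 ℕ.+ k) ℕ.* m)          ≡⟨ cong (2 ℕ.*_) (sym ∣x-y∣≡[2+k]*m) ⟩
    2 ℕ.* ∣ x - y ∣                  ∎))
    where open ℕ.≤-Reasoning

module _ {n m} (w : IVec n) (∑w²≡m² : sqNorm w ≡ + m * + m) where

  private
    sq-nonNeg : ∀ i → 0ℤ ≤ℤ w i * w i
    sq-nonNeg i = i*i-nonNeg (w i)

  norm²≡m²⇒∣wᵢ∣≤m : ∀ i → ∣ w i ∣ ℕ.≤ m
  norm²≡m²⇒∣wᵢ∣≤m i = i*i≤j*j⇒∣i∣≤∣j∣ {w i} {+ m}
    (subst (w i * w i ≤ℤ_) ∑w²≡m² (∈⇒≤∑ sq-nonNeg (∈-allFin i)))

  norm²≡m²⇒multiple≡0 : ∀ {i j} → i ≢ j → w i ≢ 0ℤ → w j ≡ + 0 [mod m ] → w j ≡ 0ℤ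
  norm²≡m²⇒multiple≡0 {i} {j} i≢j wᵢ≢0 wⱼ≡0 with w j ℤ.≟ 0ℤ
  ... | yes wⱼ≡0ℤ = wⱼ≡0ℤ
  ... | no  wⱼ≢0  = contradiction (+-cancelʳ-≤ {1ℤ} {0ℤ} (+ m * + m) (begin
    1ℤ + + m * + m          ≤⟨ ℤ.+-mono-≤ 1≤wᵢ² m²≤wⱼ² ⟩
    w i * w i + w j * w j   ≤⟨ ∈∧∈⇒+≤∑ sq-nonNeg i≢j (∈-allFin i) (∈-allFin j) ⟩
    sqNorm w                ≡⟨ ∑w²≡m² ⟩
    + m * + m               ≡⟨ ℤ.+-identityˡ (+ m * + m) ⟨
    0ℤ + + m * + m          ∎)) λ { (+≤+ ()) }
    where
    open ℤ.≤-Reasoning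
    1≤wᵢ² : 1ℤ ≤ℤ w i * w i
    1≤wᵢ² = ∣i∣≤∣j∣⇒i*i≤j*j {1ℤ} {w i} (ℕ.n≢0⇒n>0 (wᵢ≢0 ∘ ℤ.∣i∣≡0⇒i≡0))
    m²≤wⱼ² : + m * + m ≤ℤ w j * w j
    m²≤wⱼ² = ∣i∣≤∣j∣⇒i*i≤j*j {+ m} {w j} (m∣∣i∣⇒m≤∣i∣ (≡0[mod]⇒∣ {x = w j} wⱼ≡0) wⱼ≢0)

shift⇒m≤∣2x-1∣ : ∀ {m x y} → - + m < + 2 * y → + 2 * y ≤ℤ + m →
  (x ≡ y - + m) ⊎ (x ≡ y + + m) → m ℕ.≤ ∣ + 2 * x - 1ℤ ∣
shift⇒m≤∣2x-1∣ {m} {y = y} _ 2y≤m (inj₁ refl) = i≤-n⇒n≤∣i∣ (begin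
  + 2 * (y - + m) - 1ℤ   ≤⟨ ℤ.i-j≤i _ 1ℤ ⟩
  + 2 * (y - + m)        ≡⟨ expand y (+ m) ⟩
  + 2 * y - + 2 * + m    ≤⟨ ℤ.+-monoˡ-≤ (- (+ 2 * + m)) 2y≤m ⟩
  + m - + 2 * + m        ≡⟨ collect (+ m) ⟩
  - + m                  ∎)
  where
  open ℤ.≤-Reasoning
  expand : ∀ y m → + 2 * (y - m) ≡ + 2 * y - + 2 * m
  expand = solve-∀
  collect : ∀ m → m - + 2 * m ≡ - m
  collect = solve-∀
shift⇒m≤∣2x-1∣ {m} {y = y} -m<2y _ (inj₂ refl) = +n≤i⇒n≤∣i∣ (begin
  + m                            ≡⟨ split (+ m) ⟩
  1ℤ + - + m + (+ 2 * + m - 1ℤ)  ≤⟨ ℤ.+-monoˡ-≤ (+ 2 * + m - 1ℤ) (ℤ.i<j⇒suc[i]≤j -m<2y) ⟩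
  + 2 * y + (+ 2 * + m - 1ℤ)     ≡⟨ collect y (+ m) ⟩
  + 2 * (y + + m) - 1ℤ           ∎)
  where
  open ℤ.≤-Reasoning
  split : ∀ m → m ≡ 1ℤ + - m + (+ 2 * m - 1ℤ)
  split = solve-∀
  collect : ∀ y m → + 2 * y + (+ 2 * m - 1ℤ) ≡ + 2 * (y + m) - 1ℤ
  collect = solve-∀

m≤∣2x-1∣⇒m²-1≤4[x²-x] : ∀ {m x} → m ℕ.≤ ∣ + 2 * x - 1ℤ ∣ → + m * + m - 1ℤ ≤ℤ + 4 * (x * x - x)
m≤∣2x-1∣⇒m²-1≤4[x²-x] {m} {x} m≤∣2x-1∣ = begin
  + m * + m - 1ℤ                         ≤⟨ ℤ.+-monoˡ-≤ (- 1ℤ) (∣i∣≤∣j∣⇒i*i≤j*j {+ m} {+ 2 * x - 1ℤ} m≤∣2x-1∣) ⟩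
  (+ 2 * x - 1ℤ) * (+ 2 * x - 1ℤ) - 1ℤ  ≡⟨ complete-square x ⟩
  + 4 * (x * x - x)                      ∎
  where
  open ℤ.≤-Reasoning
  complete-square : ∀ x → (+ 2 * x - 1ℤ) * (+ 2 * x - 1ℤ) - 1ℤ ≡ + 4 * (x * x - x)
  complete-square = solve-∀

h*[m²-1]≤4[m²-m]⇒h≤3 : ∀ {m} h → 2 ℕ.≤ m →
  + h * (+ m * + m - 1ℤ) ≤ℤ + 4 * (+ m * + m - + m) → h ℕ.≤ 3
h*[m²-1]≤4[m²-m]⇒h≤3 {ℕ.suc (ℕ.suc k)} h (ℕ.s≤s (ℕ.s≤s _)) bound =
  ℕ.s≤s⁻¹ (ℤ.drop‿+<+ (ℤ.*-cancelʳ-<-nonNeg (p + + 2) (begin-strict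
    + h * (p + + 2)  ≤⟨ ℤ.*-cancelˡ-≤-pos _ _ p (subst₂ _≤ℤ_ (factor₁ (+ h) p) (factor₂ p) bound) ⟩
    + 4 * (p + 1ℤ)   <⟨ ℤ.*-monoˡ-<-pos (+ 4) (ℤ.+-monoʳ-< p (+<+ (ℕ.n<1+n 1))) ⟩
    + 4 * (p + + 2)  ∎)))
  where
  open ℤ.≤-Reasoning
  p : ℤ
  p = + ℕ.suc k
  factor₁ : ∀ h p → h * ((1ℤ + p) * (1ℤ + p) - 1ℤ) ≡ p * (h * (p + + 2))
  factor₁ = solve-∀
  factor₂ : ∀ p → + 4 * ((1ℤ + p) * (1ℤ + p) - (1ℤ + p)) ≡ p * (+ 4 * (p + 1ℤ))
  factor₂ = solve-∀

hammingPrefix≤3 : ∀ {n m} q (w u : IVec n) → 2 ℕ.≤ m → eᵀ w ≡ + m → sqNorm w ≡ + m * + m →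
  (∀ i → (- + m < + 2 * u i) × (+ 2 * u i ≤ℤ + m)) →
  (∀ i → toℕ i <ℕ q → w i ≢ u i → (w i ≡ u i - + m) ⊎ (w i ≡ u i + + m)) →
  hammingPrefix q w u ≤ 3
hammingPrefix≤3 {n} {m} q w u 2≤m ∑w≡m ∑w²≡m² u-bounds shifted =
  h*[m²-1]≤4[m²-m]⇒h≤3 (hammingPrefix q w u) 2≤m (begin
    + hammingPrefix q w u * (+ m * + m - 1ℤ)
      ≤⟨ length-filter*≤∑ excess-nonNeg mismatch? mismatch⇒m²-1≤excess (allFin n) ⟩
    ∑ excess (allFin n)
      ≡⟨ *-distribˡ-∑ (+ 4) (λ i → w i * w i - w i) (allFin n) ⟨
    + 4 * ∑ (λ i → w i * w i - w i) (allFin n)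
      ≡⟨ cong (_*_ (+ 4)) (∑-distrib-sub (λ i → w i * w i) w (allFin n)) ⟩
    + 4 * (sqNorm w - eᵀ w)
      ≡⟨ cong₂ (λ a b → + 4 * (a - b)) ∑w²≡m² ∑w≡m ⟩
    + 4 * (+ m * + m - + m)
      ∎)
  where
  open ℤ.≤-Reasoning
  excess : Fin n → ℤ
  excess i = + 4 * (w i * w i - w i)
  excess-nonNeg : ∀ i → 0ℤ ≤ℤ excess i
  excess-nonNeg i = ℤ.*-monoˡ-≤-nonNeg (+ 4) (i*i-i-nonNeg (w i))
  mismatch? : Decidable (λ i → (toℕ i <ℕ q) × (w i ≢ u i))
  mismatch? i = (toℕ i ℕ.<? q) ×-dec ¬? (w i ℤ.≟ u i)
  mismatch⇒m²-1≤excess : ∀ i → (toℕ i <ℕ q) × (w i ≢ u i) → + m * + m - 1ℤ ≤ℤ excess i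
  mismatch⇒m²-1≤excess i (i<q , wᵢ≢uᵢ) = m≤∣2x-1∣⇒m²-1≤4[x²-x] {m} {w i}
    (shift⇒m≤∣2x-1∣ (proj₁ (u-bounds i)) (proj₂ (u-bounds i)) (shifted i i<q wᵢ≢uᵢ))

lemma14 : (m : ℕ) → .{{_ : NonZero m}} → (n q : ℕ) → 0 <ℕ q → q ≤ n →
    (v w u : IVec n) →
    (∀ (i : Fin n) → toℕ i <ℕ q → ¬ (v i ≡ + 0 [mod m ])) →
    (∀ (j : Fin n) → q ≤ toℕ j → v j ≡ + 0 [mod m ]) →
    IsPerfectRep m v w →
    IsShortestRep m v u →
    ((∀ (i : Fin n) → toℕ i <ℕ q → (u i ≢ + 0) × (w i ≢ + 0))
      × (∀ (j : Fin n) → q ≤ toℕ j → (u j ≡ + 0) × (w j ≡ + 0)))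
    × (hammingPrefix q w u ≤ 3
      × (∀ (i : Fin n) → toℕ i <ℕ q → w i ≢ u i →
          ((w i ≡ u i - + m) × (u i > + 0)) ⊎ ((w i ≡ u i + + m) × (u i < + 0))))
lemma14 m ℕ.zero _ (ℕ.s≤s _) ()
lemma14 m (ℕ.suc n) q 0<q _ v w u v≢0 v≡0 (w≡v , ∑w≡m , ∑w²≡m²) (u≡v , u-bounds) =
  (nonzero , vanishing) , hammingPrefix≤3 q w u 2≤m ∑w≡m ∑w²≡m² u-bounds shifted , shift
  where
  2∣u∣≤m : ∀ i → 2 ℕ.* ∣ u i ∣ ℕ.≤ m
  2∣u∣≤m i = -m<2u≤m⇒2∣u∣≤m (proj₁ (u-bounds i)) (proj₂ (u-bounds i))

  nonzero : ∀ i → toℕ i <ℕ q → (u i ≢ 0ℤ) × (w i ≢ 0ℤ)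
  nonzero i i<q = ≢0[mod]⇒≢0 {m} {u i} (u≡v i) (v≢0 i i<q) , ≢0[mod]⇒≢0 {m} {w i} (w≡v i) (v≢0 i i<q)

  vanishing : ∀ j → q ≤ toℕ j → (u j ≡ 0ℤ) × (w j ≡ 0ℤ)
  vanishing j q≤j =
    ≡0[mod]∧2∣u∣≤m⇒u≡0 (≡[mod]-trans {m} {u j} {v j} {+ 0} (u≡v j) (v≡0 j q≤j)) (2∣u∣≤m j) ,
    norm²≡m²⇒multiple≡0 w ∑w²≡m² 0≢j (proj₂ (nonzero Fin.zero 0<q))
      (≡[mod]-trans {m} {w j} {v j} {+ 0} (w≡v j) (v≡0 j q≤j))
    where
    0≢j : Fin.zero ≢ j
    0≢j refl = ℕ.<⇒≱ 0<q q≤j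

  2≤m : 2 ℕ.≤ m
  2≤m = 2∣u∣≤m∧u≢0⇒2≤m (2∣u∣≤m Fin.zero) (proj₁ (nonzero Fin.zero 0<q))

  shift : ∀ i → toℕ i <ℕ q → w i ≢ u i → ((w i ≡ u i - + m) × (u i > 0ℤ)) ⊎ ((w i ≡ u i + + m) × (u i < 0ℤ))
  shift i i<q = congruent-shift (≡[mod]-trans {m} {w i} {v i} {u i} (w≡v i) (≡[mod]-sym {m} {u i} (u≡v i)))
    (norm²≡m²⇒∣wᵢ∣≤m w ∑w²≡m² i) (2∣u∣≤m i) (proj₁ (nonzero i i<q))

  shifted : ∀ i → toℕ i <ℕ q → w i ≢ u i → (w i ≡ u i - + m) ⊎ (w i ≡ u i + + m)
  shifted i i<q = Sum.map proj₁ proj₁ ∘ shift i i<q
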